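{- Let $\mathcal{K}$ be a discrete valued field with maximal ideal $\mathfrak{m}$ and finite residue field $\mathbb{F}_q$, let $n\ge1$, let $2\le\ell\le k$ and let $S\subseteq\mathbb{B}_n$. Then the following are equivalent: \begin{enumerate} \item $S$ is $(k,\ell)$-orthogonal; \item for every $\mathcal{I}\subseteq\mathbb{P}^{n-1}(\mathbb{F}_q)$ of dimension at most $\ell-2$, we have $\sum_{\mathbf{w}\in\mathcal{I}}t_{\mathbf{w},S}\le k-1$. \end{enumerate}
   Context: The absolute value on $\mathcal{K}$ is $|\lambda|=q^{ -\nu(\lambda)}$ for the valuation $\nu$, and $\mathcal{K}^n$ carries the norm $\Vert\mathbf{v}\Vert=\max_i|v_i|$; $\mathbb{B}_n=\{\mathbf{v}\in\mathcal{K}^n:\Vert\mathbf{v}\Vert=1\}$. $\gamma_n:\mathbb{B}_n\to\mathbb{F}_q^n\setminus\{\mathbf 0\}$ is coordinatewise reduction modulo $\mathfrak{m}$ and $\rho_n:\mathbb{F}_q^n\setminus\{\mathbf0\}\to\mathbb{P}^{n-1}(\mathbb{F}_q)$ the canonical projection. For $\mathbf{w}\in\mathbb{P}^{n-1}(\mathbb{F}_q)$, $t_{\mathbf{w},S}=|\{\mathbf{v}\in S:(\rho_n\circ\gamma_n)(\mathbf{v})=\mathbf{w}\}|$. The dimension of a subset $\mathcal{I}\subseteq\mathbb{P}^{n-1}(\mathbb{F}_q)$ is the projective dimension of the projective subspace it spans (one less than the $\mathbb{F}_q$-dimension of the span of representatives). Nonzero vectors $\mathbf{u}_1,\dots,\mathbf{u}_\ell$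 are orthogonal if $\Vert\sum_i\lambda_i\mathbf{u}_i\Vert=\max_i\Vert\lambda_i\mathbf{u}_i\Vert$ for all $\lambda_i\in\mathcal{K}$; $S$ is $(k,\ell)$-orthogonal if every $E\subseteq S$ with $|E|=k$ contains an orthogonal subset of size $\ell$. -}

module Defs where

open import Level using (0ℓ)
open import Data.Nat using (ℕ; zero; suc)
open import Data.Integer as ℤ using (ℤ; 0ℤ)
open import Data.Fin using (Fin; zero; suc)
open import Data.Product using (Σ; ∃; _×_; _,_)
open import Relation.Nullary using (¬_; Dec)
open import Relation.Binary.PropositionalEquality using (_≡_)
open import Algebra.Bundles using (CommutativeRing)

data ℤ∞ : Set where
  fin : ℤ → ℤ∞
  ∞   : ℤ∞

_+∞_ : ℤ∞ → ℤ∞ → ℤ∞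
fin a +∞ fin b = fin (a ℤ.+ b)
fin _ +∞ ∞     = ∞
∞     +∞ _     = ∞

min∞ : ℤ∞ → ℤ∞ → ℤ∞
min∞ (fin a) (fin b) = fin (a ℤ.⊓ b)
min∞ (fin a) ∞       = fin a
min∞ ∞       y       = y

data _≤∞_ : ℤ∞ → ℤ∞ → Set where
  fin≤fin : ∀ {a b} → a ℤ.≤ b → fin a ≤∞ fin b
  _≤∞∞    : ∀ x → x ≤∞ ∞

data _<∞_ : ℤ∞ → ℤ∞ → Set where
  fin<fin : ∀ {a b} → a ℤ.< b → fin a <∞ fin b
  fin<∞   : ∀ {a} → fin a <∞ ∞

minFin : (m : ℕ) → (Fin m → ℤ∞) → ℤ∞
minFin zero    f = ∞
minFin (suc m) f = min∞ (f zero) (minFin m (λ i → f (suc i)))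

record Field : Set₁ where
  field
    commRing : CommutativeRing 0ℓ 0ℓ
  open CommutativeRing commRing public
  field
    1≉0     : ¬ (1# ≈ 0#)
    inverse : ∀ x → ¬ (x ≈ 0#) → ∃ λ y → (x * y) ≈ 1#

module FieldOps (F : Field) where
  open Field F using (Carrier; 0#; _+_)
  sumFin : (m : ℕ) → (Fin m → Carrier) → Carrier
  sumFin zero    f = 0#
  sumFin (suc m) f = f zero + sumFin m (λ i → f (suc i))

-- A discrete valued field 𝒦 with valuation ν (normalised, ν(𝒦ˣ) = ℤ)
-- and finite residue field 𝔽 = 𝒪/𝔪 with q elements, given by the
-- reduction map red : 𝒪 → 𝔽 (red is only constrained on 𝒪 = {ν ≥ 0}).

record DVF : Set₁ where
  field
    K : Field
    F : Field
  module K = Field K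
  module F = Field F
  field
    ν        : K.Carrier → ℤ∞
    ν-cong   : ∀ {x y} → x K.≈ y → ν x ≡ ν y
    ν-∞⇒0    : ∀ x → ν x ≡ ∞ → x K.≈ K.0#
    ν-0      : ν K.0# ≡ ∞
    ν-mul    : ∀ x y → ν (x K.* y) ≡ ν x +∞ ν y
    ν-add    : ∀ x y → min∞ (ν x) (ν y) ≤∞ ν (x K.+ y)
    ν-surj   : ∀ z → ∃ λ x → ν x ≡ fin z
    q        : ℕ
    enum     : Fin q → F.Carrier
    enum-inj : ∀ i j → enum i F.≈ enum j → i ≡ j
    enum-sur : ∀ a → ∃ λ i → enum i F.≈ a
    _≟F_     : ∀ a b → Dec (a F.≈ b)
    red      : K.Carrier → F.Carrier
    red-cong : ∀ {x y} → x K.≈ y → red x F.≈ red y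
    red-+    : ∀ x y → fin 0ℤ ≤∞ ν x → fin 0ℤ ≤∞ ν y →
               red (x K.+ y) F.≈ (red x F.+ red y)
    red-*    : ∀ x y → fin 0ℤ ≤∞ ν x → fin 0ℤ ≤∞ ν y →
               red (x K.* y) F.≈ (red x F.* red y)
    red-1    : red K.1# F.≈ F.1#
    red-sur  : ∀ a → ∃ λ x → (fin 0ℤ ≤∞ ν x) × (red x F.≈ a)
    red-ker⇒ : ∀ x → fin 0ℤ ≤∞ ν x → red x F.≈ F.0# → fin 0ℤ <∞ ν x
    red-ker⇐ : ∀ x → fin 0ℤ <∞ ν x → red x F.≈ F.0#

module Vectors (D : DVF) where
  open DVF D
  open FieldOps K renaming (sumFin to sumK)
  open FieldOps F renaming (sumFin to sumF)

  Vecₖ : ℕ → Set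
  Vecₖ n = Fin n → K.Carrier

  Vecꜰ : ℕ → Set
  Vecꜰ n = Fin n → F.Carrier

  _≈ᵥ_ : ∀ {n} → Vecₖ n → Vecₖ n → Set
  u ≈ᵥ w = ∀ i → u i K.≈ w i

  _≈ꜰ_ : ∀ {n} → Vecꜰ n → Vecꜰ n → Set
  u ≈ꜰ w = ∀ i → u i F.≈ w i

  -- valuation of a vector: ‖v‖ = max |vᵢ| = q^{-min ν(vᵢ)}
  νᵥ : ∀ {n} → Vecₖ n → ℤ∞
  νᵥ {n} u = minFin n (λ i → ν (u i))

  InB : ∀ {n} → Vecₖ n → Set
  InB u = νᵥ u ≡ fin 0ℤ

  scale : ∀ {n} → K.Carrier → Vecₖ n → Vecₖ n
  scale c u i = c K.* u i

  lincomb : ∀ {n m} → (Fin m → K.Carrier) → (Fin m → Vecₖ n) → Vecₖ n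
  lincomb {m = m} c u j = sumK m (λ i → c i K.* u i j)

  -- u₁,…,u_m nonzero and orthogonal:
  -- ‖Σ λᵢ uᵢ‖ = max ‖λᵢ uᵢ‖, i.e. ν(Σ λᵢ uᵢ) = min ν(λᵢ uᵢ)
  Orthogonal : ∀ {n m} → (Fin m → Vecₖ n) → Set
  Orthogonal {m = m} u =
    (∀ i → ¬ (νᵥ (u i) ≡ ∞)) ×
    (∀ (c : Fin m → K.Carrier) →
       νᵥ (lincomb c u) ≡ minFin m (λ i → νᵥ (scale (c i) (u i))))

  Distinct : ∀ {n m} → (Fin m → Vecₖ n) → Set
  Distinct f = ∀ i j → f i ≈ᵥ f j → i ≡ j

  InjectiveFin : ∀ {a b} → (Fin a → Fin b) → Set
  InjectiveFin g = ∀ i j → g i ≡ g j → i ≡ j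

  KLOrthogonal : ∀ {n} → ℕ → ℕ → (Vecₖ n → Set) → Set
  KLOrthogonal {n} k ℓ S =
    ∀ (f : Fin k → Vecₖ n) → (∀ i → S (f i)) → Distinct f →
    ∃ λ (g : Fin ℓ → Fin k) → InjectiveFin g × Orthogonal (λ i → f (g i))

  γ : ∀ {n} → Vecₖ n → Vecꜰ n
  γ u i = red (u i)

  lincombꜰ : ∀ {n m} → (Fin m → F.Carrier) → (Fin m → Vecꜰ n) → Vecꜰ n
  lincombꜰ {m = m} c u j = sumF m (λ i → c i F.* u i j)

  -- A subset 𝓘 ⊆ ℙⁿ⁻¹(𝔽_q), represented by the set of all its
  -- representatives in 𝔽_qⁿ ∖ {0} (closed under ≈ and nonzero scaling).
  record ProjSubset (n : ℕ) : Set₁ where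
    field
      Rep      : Vecꜰ n → Set
      nonzero  : ∀ w → Rep w → ¬ (∀ i → w i F.≈ F.0#)
      resp     : ∀ w w′ → w ≈ꜰ w′ → Rep w → Rep w′
      scaled   : ∀ w c → ¬ (c F.≈ F.0#) → Rep w → Rep (λ i → c F.* w i)
      unscaled : ∀ w c → ¬ (c F.≈ F.0#) → Rep (λ i → c F.* w i) → Rep w

  -- projective dimension of 𝓘 is ≤ d - 1, i.e. the 𝔽_q-span of its
  -- representatives has dimension ≤ d (is contained in a span of d vectors)
  SpanDim≤ : ∀ {n} → ProjSubset n → ℕ → Set
  SpanDim≤ {n} I d =
    ∃ λ (b : Fin d → Vecꜰ n) →
      ∀ w → ProjSubset.Rep I w → ∃ λ (c : Fin d → F.Carrier) → w ≈ꜰ lincombꜰ c b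

  -- Σ_{w ∈ 𝓘} t_{w,S} ≤ k - 1 : the set {v ∈ S : (ρₙ∘γₙ)(v) ∈ 𝓘}
  -- (whose cardinality is this sum) has no k distinct elements
  CountBelow : ∀ {n} → ℕ → (Vecₖ n → Set) → ProjSubset n → Set
  CountBelow {n} k S I =
    ¬ (∃ λ (f : Fin k → Vecₖ n) →
         (∀ i → S (f i) × ProjSubset.Rep I (γ (f i))) × Distinct f)

-- For vectors of norm 1, orthogonality is the same as linear independence of the
-- reductions modulo 𝔪: after scaling a linear combination so that its largest
-- coefficient is a unit, the combination has norm 1 exactly when its reduction is
-- nonzero. So S is (k,ℓ)-orthogonal iff among any k of its elements some ℓ have
-- independent reductions. If k elements reduce into a projective subspace of
-- dimension ≤ ℓ − 2, i.e. into the span of ℓ − 1 vectors, no ℓ of them can be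
-- independent. Conversely, if k elements have no ℓ independent reductions, a maximal
-- independent subfamily of the reductions has fewer than ℓ members and spans all of
-- them, which yields such a subspace.

module Submission where

open import Defs
open import Data.Nat using (ℕ; _≤_; _∸_)
open import Data.Product using (_×_)
open import Function.Bundles using (_⇔_)

open import Data.Nat as ℕ using (zero; suc; _≤′_; ≤′-refl; ≤′-step)
open import Data.Nat.Properties using (≤⇒≤′; ≰⇒>; ≤-pred)
open import Data.Integer as ℤ using (0ℤ)
import Data.Integer.Properties as ℤ
open import Algebra.Properties.AbelianGroup ℤ.+-0-abelianGroup using (inverseʳ-unique)
open import Data.Fin using (Fin; zero; suc; punchIn; punchOut)
open import Data.Fin.Properties using (all?; any?; ¬∀⟶∃¬; punchIn-punchOut; suc-injective)
import Data.Fin.Properties as Fin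
open import Data.Vec using (Vec; []; _∷_; lookup; tabulate)
open import Data.Vec.Properties using (lookup∘tabulate)
open import Data.Vec.Functional using (Vector; tail) renaming (_∷_ to _∷ᵥ_)
open import Data.Product using (∃; _,_; proj₁; proj₂)
open import Data.Sum using (_⊎_; inj₁; inj₂)
open import Data.Empty using (⊥-elim)
open import Function using (_∘_; Injective; mk⇔; Equivalence)
open import Relation.Nullary using (¬_; Dec; yes; no)
import Relation.Nullary.Decidable as Dec
open import Relation.Binary.PropositionalEquality as ≡ using (_≡_; _≢_)

module ℤ∞-Properties where
  open ≡ using (refl; sym; trans; cong; cong₂; subst)

  ≤∞-trans : ∀ {x y z} → x ≤∞ y → y ≤∞ z → x ≤∞ z
  ≤∞-trans (fin≤fin p) (fin≤fin q) = fin≤fin (ℤ.≤-trans p q)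
  ≤∞-trans {x} _       (_ ≤∞∞)     = x ≤∞∞

  <∞-≤∞-trans : ∀ {x y z} → x <∞ y → y ≤∞ z → x <∞ z
  <∞-≤∞-trans (fin<fin p) (fin≤fin q) = fin<fin (ℤ.<-≤-trans p q)
  <∞-≤∞-trans (fin<fin p) (_ ≤∞∞)     = fin<∞
  <∞-≤∞-trans fin<∞       (_ ≤∞∞)     = fin<∞

  <∞-irrefl : ∀ {x} → ¬ (x <∞ x)
  <∞-irrefl (fin<fin p) = ℤ.<-irrefl refl p

  ∞≤∞⇒≡∞ : ∀ {x} → ∞ ≤∞ x → x ≡ ∞
  ∞≤∞⇒≡∞ (_ ≤∞∞) = refl

  ≤∞∧≮∞⇒≡ : ∀ {a x} → fin a ≤∞ x → ¬ (fin a <∞ x) → x ≡ fin a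
  ≤∞∧≮∞⇒≡ {a} {fin b} (fin≤fin a≤b) a≮b with a ℤ.≟ b
  ... | yes a≡b = cong fin (sym a≡b)
  ... | no  a≢b = ⊥-elim (a≮b (fin<fin (ℤ.≤∧≢⇒< a≤b a≢b)))
  ≤∞∧≮∞⇒≡ (_ ≤∞∞) a≮∞ = ⊥-elim (a≮∞ fin<∞)

  +∞-identityʳ : ∀ x → x +∞ fin 0ℤ ≡ x
  +∞-identityʳ (fin a) = cong fin (ℤ.+-identityʳ a)
  +∞-identityʳ ∞       = refl

  +∞-nonneg : ∀ {x y} → fin 0ℤ ≤∞ x → fin 0ℤ ≤∞ y → fin 0ℤ ≤∞ (x +∞ y)
  +∞-nonneg (fin≤fin p) (fin≤fin q) = fin≤fin (ℤ.+-mono-≤ p q)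
  +∞-nonneg (fin≤fin p) (_ ≤∞∞)     = _ ≤∞∞
  +∞-nonneg (_ ≤∞∞)     _           = _ ≤∞∞

  neg-+∞-nonneg : ∀ z {x} → fin z ≤∞ x → fin 0ℤ ≤∞ (fin (ℤ.- z) +∞ x)
  neg-+∞-nonneg z {fin b} (fin≤fin z≤b) =
    fin≤fin (subst (ℤ._≤ ℤ.- z ℤ.+ b) (ℤ.+-inverseˡ z) (ℤ.+-monoʳ-≤ (ℤ.- z) z≤b))
  neg-+∞-nonneg z (_ ≤∞∞)       = _ ≤∞∞

  neg-+∞-zero : ∀ z x → fin (ℤ.- z) +∞ x ≡ fin 0ℤ ⇔ x ≡ fin z
  neg-+∞-zero z (fin b) = mk⇔
    (λ eq → cong fin (trans (inverseʳ-unique (ℤ.- z) b (fin-injective eq)) (ℤ.neg-involutive z)))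
    (λ { refl → cong fin (ℤ.+-inverseˡ z) })
    where fin-injective : ∀ {a b} → fin a ≡ fin b → a ≡ b
          fin-injective refl = refl
  neg-+∞-zero z ∞       = mk⇔ (λ ()) (λ ())

  min∞-≤ˡ : ∀ x y → min∞ x y ≤∞ x
  min∞-≤ˡ (fin a) (fin b) = fin≤fin (ℤ.i⊓j≤i a b)
  min∞-≤ˡ (fin a) ∞       = fin≤fin ℤ.≤-refl
  min∞-≤ˡ ∞       y       = y ≤∞∞

  min∞-≤ʳ : ∀ x y → min∞ x y ≤∞ y
  min∞-≤ʳ (fin a) (fin b) = fin≤fin (ℤ.i⊓j≤j a b)
  min∞-≤ʳ (fin a) ∞       = fin a ≤∞∞
  min∞-≤ʳ ∞       (fin b) = fin≤fin ℤ.≤-refl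
  min∞-≤ʳ ∞       ∞       = ∞ ≤∞∞

  min∞-glb : ∀ {z x y} → z ≤∞ x → z ≤∞ y → z ≤∞ min∞ x y
  min∞-glb (fin≤fin p) (fin≤fin q) = fin≤fin (ℤ.⊓-glb p q)
  min∞-glb (fin≤fin p) (_ ≤∞∞)     = fin≤fin p
  min∞-glb (_ ≤∞∞)     q           = q

  min∞-sel : ∀ x y → min∞ x y ≡ x ⊎ min∞ x y ≡ y
  min∞-sel (fin a) (fin b) with ℤ.⊓-sel a b
  ... | inj₁ eq = inj₁ (cong fin eq)
  ... | inj₂ eq = inj₂ (cong fin eq)
  min∞-sel (fin a) ∞ = inj₁ refl
  min∞-sel ∞       y = inj₂ refl

  min∞-+ : ∀ a x y → min∞ (a +∞ x) (a +∞ y) ≡ a +∞ min∞ x y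
  min∞-+ ∞       x       y       = refl
  min∞-+ (fin a) (fin x) (fin y) = cong fin (sym (ℤ.mono-≤-distrib-⊓ (ℤ.+-monoʳ-≤ a) x y))
  min∞-+ (fin a) (fin x) ∞       = refl
  min∞-+ (fin a) ∞       y       = refl

  minFin-≤ : ∀ m (f : Fin m → ℤ∞) i → minFin m f ≤∞ f i
  minFin-≤ (suc m) f zero    = min∞-≤ˡ _ _
  minFin-≤ (suc m) f (suc i) = ≤∞-trans (min∞-≤ʳ _ _) (minFin-≤ m _ i)

  minFin-glb : ∀ m {z} (f : Fin m → ℤ∞) → (∀ i → z ≤∞ f i) → z ≤∞ minFin m f
  minFin-glb zero    {z} f z≤f = z ≤∞∞
  minFin-glb (suc m)     f z≤f = min∞-glb (z≤f zero) (minFin-glb m _ (z≤f ∘ suc))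

  minFin-attained : ∀ m (f : Fin m → ℤ∞) {z} → minFin m f ≡ fin z → ∃ λ i → f i ≡ fin z
  minFin-attained (suc m) f eq with min∞-sel (f zero) (minFin m (f ∘ suc))
  ... | inj₁ eq₀ = zero , trans (sym eq₀) eq
  ... | inj₂ eq₁ with minFin-attained m (f ∘ suc) (trans (sym eq₁) eq)
  ... | i , fᵢ≡z = suc i , fᵢ≡z

  minFin-glb< : ∀ m {z} (f : Fin m → ℤ∞) → (∀ i → fin z <∞ f i) → fin z <∞ minFin m f
  minFin-glb< m f z<f with minFin m f in eq
  ... | ∞     = fin<∞
  ... | fin w with minFin-attained m f eq
  ... | i , fᵢ≡w = subst (fin _ <∞_) fᵢ≡w (z<f i)

  minFin-cong : ∀ m {f g : Fin m → ℤ∞} → (∀ i → f i ≡ g i) → minFin m f ≡ minFin m g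
  minFin-cong zero    f≡g = refl
  minFin-cong (suc m) f≡g = cong₂ min∞ (f≡g zero) (minFin-cong m (f≡g ∘ suc))

  minFin-+ : ∀ m a (f : Fin m → ℤ∞) → minFin m (λ i → a +∞ f i) ≡ a +∞ minFin m f
  minFin-+ zero    (fin a) f = refl
  minFin-+ zero    ∞       f = refl
  minFin-+ (suc m) a       f = trans (cong (min∞ (a +∞ f zero)) (minFin-+ m a (f ∘ suc))) (min∞-+ a _ _)

  fin≢∞ : ∀ {a} → fin a ≢ ∞
  fin≢∞ ()

open ℤ∞-Properties

-- Coefficients are searched as Vec rather than as functions: splitting off the
-- head of a Vec needs no function extensionality.
∃-vec? : ∀ {q} s {P : Vec (Fin q) s → Set} → (∀ v → Dec (P v)) → Dec (∃ P)
∃-vec? zero    P? = Dec.map′ ([] ,_) (λ { ([] , p) → p }) (P? [])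
∃-vec? (suc s) P? = Dec.map′ (λ (x , xs , p) → x ∷ xs , p) (λ { (x ∷ xs , p) → x , xs , p })
                             (any? λ x → ∃-vec? s (λ xs → P? (x ∷ xs)))

module Linear (F : Field) where
  open Field F hiding (zero)
  open import Algebra.Properties.Semiring.Sum semiring
  open import Algebra.Properties.Ring ring using (-‿distribˡ-*; -‿distribʳ-*)
  open import Algebra.Properties.Group +-group using (inverseˡ-unique)
  open import Data.Vec.Functional.Relation.Binary.Equality.Setoid setoid using (_≋_)
  open import Relation.Binary.Reasoning.Setoid setoid

  sumFin≡sum : ∀ m (f : Vector Carrier m) → FieldOps.sumFin F m f ≡ sum f
  sumFin≡sum zero    f = ≡.refl
  sumFin≡sum (suc m) f = ≡.cong (f zero +_) (sumFin≡sum m (tail f))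

  lincomb : ∀ {m n} → Vector Carrier m → (Fin m → Vector Carrier n) → Vector Carrier n
  lincomb {m} a u t = ∑[ i < m ] (a i * u i t)

  IsZero : ∀ {n} → Vector Carrier n → Set
  IsZero v = ∀ t → v t ≈ 0#

  Independent : ∀ {m n} → (Fin m → Vector Carrier n) → Set
  Independent u = ∀ a → IsZero (lincomb a u) → IsZero a

  Dependent : ∀ {m n} → (Fin m → Vector Carrier n) → Set
  Dependent u = ∃ λ a → (∃ λ i → ¬ a i ≈ 0#) × IsZero (lincomb a u)

  InSpan : ∀ {s n} → (Fin s → Vector Carrier n) → Vector Carrier n → Set
  InSpan b w = ∃ λ c → w ≋ lincomb c b

  sum-zero : ∀ {m} {f : Vector Carrier m} → IsZero f → sum f ≈ 0#
  sum-zero {m} f≈0 = trans (sum-cong-≋ f≈0) (sum-replicate-zero m)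

  lincomb-congˡ : ∀ {m n} {a a′ : Vector Carrier m} (u : Fin m → Vector Carrier n) →
                  a ≋ a′ → lincomb a u ≋ lincomb a′ u
  lincomb-congˡ u a≋a′ t = sum-cong-≋ (λ i → *-congʳ (a≋a′ i))

  lincomb-zeroˡ : ∀ {m n} {a : Vector Carrier m} (u : Fin m → Vector Carrier n) →
                  IsZero a → IsZero (lincomb a u)
  lincomb-zeroˡ u a≈0 t = sum-zero (λ i → trans (*-congʳ (a≈0 i)) (zeroˡ _))

  *-lincomb : ∀ {m n} c (a : Vector Carrier m) (u : Fin m → Vector Carrier n) t →
              c * lincomb a u t ≈ lincomb (λ i → c * a i) u t
  *-lincomb c a u t = trans (*-distribˡ-sum c (λ i → a i * u i t)) (sum-cong-≋ (λ i → sym (*-assoc c (a i) _)))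

  lincomb-lincomb : ∀ {m s n} (a : Vector Carrier m) (C : Fin m → Vector Carrier s)
                    (b : Fin s → Vector Carrier n) →
                    lincomb a (λ i → lincomb (C i) b) ≋ lincomb (lincomb a C) b
  lincomb-lincomb {m} {s} a C b t = begin
    ∑[ i < m ] (a i * ∑[ j < s ] (C i j * b j t))
      ≈⟨ sum-cong-≋ (λ i → *-lincomb (a i) (C i) b t) ⟩
    ∑[ i < m ] ∑[ j < s ] ((a i * C i j) * b j t)
      ≈⟨ ∑-comm (λ i j → (a i * C i j) * b j t) ⟩
    ∑[ j < s ] ∑[ i < m ] ((a i * C i j) * b j t)
      ≈⟨ sum-cong-≋ (λ j → *-distribʳ-sum (b j t) (λ i → a i * C i j)) ⟨
    ∑[ j < s ] (lincomb a C j * b j t)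
      ∎

  inverse-cancelˡ : ∀ {c} (c≉0 : ¬ c ≈ 0#) x → proj₁ (inverse c c≉0) * (c * x) ≈ x
  inverse-cancelˡ {c} c≉0 x = begin
    e * (c * x)   ≈⟨ *-assoc e c x ⟨
    (e * c) * x   ≈⟨ *-congʳ (trans (*-comm e c) (proj₂ (inverse c c≉0))) ⟩
    1# * x        ≈⟨ *-identityˡ x ⟩
    x             ∎
    where e = proj₁ (inverse c c≉0)

  *-cancelˡ-0 : ∀ {c x} → ¬ c ≈ 0# → c * x ≈ 0# → x ≈ 0#
  *-cancelˡ-0 {c} {x} c≉0 cx≈0 = trans (sym (inverse-cancelˡ c≉0 x)) (trans (*-congˡ cx≈0) (zeroʳ _))

  InSpan-resp : ∀ {s n} (b : Fin s → Vector Carrier n) {w w′} → w ≋ w′ → InSpan b w → InSpan b w′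
  InSpan-resp b w≋w′ (c , w≋cb) = c , λ t → trans (sym (w≋w′ t)) (w≋cb t)

  InSpan-* : ∀ {s n} (b : Fin s → Vector Carrier n) c {w} → InSpan b w → InSpan b (λ t → c * w t)
  InSpan-* b c (a , w≋ab) = (λ i → c * a i) , λ t → trans (*-congˡ (w≋ab t)) (*-lincomb c a b t)

  InSpan-∷ : ∀ {s n} (b : Fin s → Vector Carrier n) v {w} → InSpan b w → InSpan (v ∷ᵥ b) w
  InSpan-∷ b v (c , w≋cb) = (0# ∷ᵥ c) , λ t →
    trans (w≋cb t) (sym (trans (+-congʳ (zeroˡ (v t))) (+-identityˡ _)))

  InSpan-head : ∀ {s n} (b : Fin s → Vector Carrier n) v → InSpan (v ∷ᵥ b) v
  InSpan-head b v = (1# ∷ᵥ λ _ → 0#) , λ t →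
    sym (trans (+-cong (*-identityˡ (v t)) (lincomb-zeroˡ b (λ _ → refl) t)) (+-identityʳ (v t)))

  independent-tail : ∀ {s n} (u : Fin (suc s) → Vector Carrier n) → Independent u → Independent (tail u)
  independent-tail u ind a a·u≈0 i =
    ind (0# ∷ᵥ a) (λ t → trans (+-congʳ (zeroˡ (u zero t))) (trans (+-identityˡ _) (a·u≈0 t))) (suc i)

  dependent⇒¬independent : ∀ {m n} {u : Fin m → Vector Carrier n} → Dependent u → ¬ Independent u
  dependent⇒¬independent (a , (i , aᵢ≉0) , a·u≈0) ind = aᵢ≉0 (ind a a·u≈0 i)

  truncate : ∀ {ℓ s n} (u : Fin s → Vector Carrier n) → ℓ ≤′ s → Independent u →
             ∃ λ (g : Fin ℓ → Fin s) → Injective _≡_ _≡_ g × Independent (u ∘ g)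
  truncate u ≤′-refl        ind = (λ i → i) , (λ eq → eq) , ind
  truncate u (≤′-step ℓ≤′s) ind with truncate (tail u) ℓ≤′s (independent-tail u ind)
  ... | g , g-inj , ind′ = suc ∘ g , g-inj ∘ suc-injective , ind′

  pad : ∀ {s d n} → s ≤′ d → (b : Fin s → Vector Carrier n) →
        ∃ λ (b′ : Fin d → Vector Carrier n) → ∀ {w} → InSpan b w → InSpan b′ w
  pad ≤′-refl        b = b , λ w∈b → w∈b
  pad (≤′-step s≤′d) b with pad s≤′d b
  ... | b′ , b⊆b′ = ((λ _ → 0#) ∷ᵥ b′) , InSpan-∷ b′ (λ _ → 0#) ∘ b⊆b′

  lincomb-shear : ∀ {m n} (a y : Vector Carrier m) (v : Fin m → Vector Carrier n) z →
                  lincomb a (λ i t → v i t + y i * z t) ≋ lincomb (∑[ i < m ] (a i * y i) ∷ᵥ a) (z ∷ᵥ v)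
  lincomb-shear {m} a y v z t = begin
    ∑[ i < m ] (a i * (v i t + y i * z t))
      ≈⟨ sum-cong-≋ (λ i → trans (distribˡ (a i) _ _) (+-congˡ (sym (*-assoc (a i) _ _)))) ⟩
    ∑[ i < m ] (a i * v i t + (a i * y i) * z t)
      ≈⟨ ∑-distrib-+ (λ i → a i * v i t) (λ i → (a i * y i) * z t) ⟩
    lincomb a v t + ∑[ i < m ] ((a i * y i) * z t)
      ≈⟨ +-congˡ (*-distribʳ-sum (z t) (λ i → a i * y i)) ⟨
    lincomb a v t + ∑[ i < m ] (a i * y i) * z t
      ≈⟨ +-comm _ _ ⟩
    ∑[ i < m ] (a i * y i) * z t + lincomb a v t
      ∎

  clearColumn : ∀ {m n} (u : Fin (suc m) → Vector Carrier n) → Fin n → Carrier → Fin m → Vector Carrier n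
  clearColumn u j e i t = u (suc i) t + (- (u (suc i) j * e)) * u zero t

  clearColumn-pivot : ∀ {m n} (u : Fin (suc m) → Vector Carrier n) j e →
                      u zero j * e ≈ 1# → ∀ i → clearColumn u j e i j ≈ 0#
  clearColumn-pivot u j e u₀ⱼe≈1 i = begin
    x + (- (x * e)) * u zero j   ≈⟨ +-congˡ (-‿distribˡ-* (x * e) (u zero j)) ⟨
    x + - ((x * e) * u zero j)   ≈⟨ +-congˡ (-‿cong (*-assoc x e (u zero j))) ⟩
    x + - (x * (e * u zero j))   ≈⟨ +-congˡ (-‿cong (*-congˡ (trans (*-comm e (u zero j)) u₀ⱼe≈1))) ⟩
    x + - (x * 1#)               ≈⟨ +-congˡ (-‿cong (*-identityʳ x)) ⟩
    x + - x                      ≈⟨ -‿inverseʳ x ⟩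
    0#                           ∎
    where x = u (suc i) j

  dependent-clearColumn : ∀ {m n} (u : Fin (suc m) → Vector Carrier n) j e →
                          Dependent (clearColumn u j e) → Dependent u
  dependent-clearColumn {m} u j e (a , (i , aᵢ≉0) , a·w≈0) =
    (∑[ i < m ] (a i * y i) ∷ᵥ a) , (suc i , aᵢ≉0) ,
    λ t → trans (sym (lincomb-shear a y (tail u) (u zero) t)) (a·w≈0 t)
    where y : Vector Carrier m
          y i = - (u (suc i) j * e)

  dependent-punchIn : ∀ {m n} (v : Fin m → Vector Carrier (suc n)) j → (∀ i → v i j ≈ 0#) →
                      Dependent (λ i → v i ∘ punchIn j) → Dependent v
  dependent-punchIn v j vⱼ≈0 (a , nz , a·v≈0) = a , nz , a·v≈0′
    where
    a·v≈0′ : IsZero (lincomb a v)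
    a·v≈0′ t with j Fin.≟ t
    ... | yes ≡.refl = sum-zero (λ i → trans (*-congˡ (vⱼ≈0 i)) (zeroʳ (a i)))
    ... | no j≢t     = ≡.subst (λ t → lincomb a v t ≈ 0#) (punchIn-punchOut j≢t) (a·v≈0 (punchOut j≢t))

  dependent-coordinates : ∀ {m s n} (b : Fin s → Vector Carrier n) {u : Fin m → Vector Carrier n}
                          (C : Fin m → Vector Carrier s) → (∀ i → u i ≋ lincomb (C i) b) →
                          Dependent C → Dependent u
  dependent-coordinates b {u} C u≋Cb (a , nz , a·C≈0) = a , nz , λ t → begin
    lincomb a u t                          ≈⟨ sum-cong-≋ (λ i → *-congˡ (u≋Cb i t)) ⟩
    lincomb a (λ i → lincomb (C i) b) t    ≈⟨ lincomb-lincomb a C b t ⟩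
    lincomb (lincomb a C) b t              ≈⟨ lincomb-zeroˡ b a·C≈0 t ⟩
    0#                                     ∎

  module WithDecidableEquality (_≟_ : ∀ a b → Dec (a ≈ b)) where

    -- Gaussian elimination: unless row 0 vanishes, it clears a column on which it is
    -- nonzero, and deleting that column leaves one row more than coordinates.
    overfull-dependent : ∀ {d} (u : Fin (suc d) → Vector Carrier d) → Dependent u
    overfull-dependent {zero} u = (1# ∷ᵥ λ _ → 0#) , (zero , 1≉0) , λ ()
    overfull-dependent {suc d} u with all? (λ j → u zero j ≟ 0#)
    ... | yes u₀≈0 = (1# ∷ᵥ λ _ → 0#) , (zero , 1≉0) , λ t →
      trans (+-cong (trans (*-identityˡ _) (u₀≈0 t)) (lincomb-zeroˡ (tail u) (λ _ → refl) t)) (+-identityˡ 0#)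
    ... | no u₀≉0 with ¬∀⟶∃¬ _ _ (λ j → u zero j ≟ 0#) u₀≉0
    ... | j , u₀ⱼ≉0 with inverse (u zero j) u₀ⱼ≉0
    ... | e , u₀ⱼe≈1 = dependent-clearColumn u j e
      (dependent-punchIn (clearColumn u j e) j (clearColumn-pivot u j e u₀ⱼe≈1)
        (overfull-dependent (λ i → clearColumn u j e i ∘ punchIn j)))

    span-dependent : ∀ {d n} (b : Fin d → Vector Carrier n) (u : Fin (suc d) → Vector Carrier n) →
                     (∀ i → InSpan b (u i)) → Dependent u
    span-dependent b u u⊆b =
      dependent-coordinates b (proj₁ ∘ u⊆b) (proj₂ ∘ u⊆b) (overfull-dependent (proj₁ ∘ u⊆b))

    independent-∷ : ∀ {s n} {u : Fin s → Vector Carrier n} {w} →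
                    Independent u → ¬ InSpan u w → Independent (w ∷ᵥ u)
    independent-∷ {u = u} {w} ind w∉u a a·wu≈0 with a zero ≟ 0#
    ... | yes a₀≈0 = λ { zero → a₀≈0 ; (suc i) → ind (tail a) tail≈0 i }
      where
      tail≈0 : IsZero (lincomb (tail a) u)
      tail≈0 t =
        trans (sym (trans (+-congʳ (trans (*-congʳ a₀≈0) (zeroˡ (w t)))) (+-identityˡ _))) (a·wu≈0 t)
    ... | no a₀≉0 = ⊥-elim (w∉u ((λ i → - e * a (suc i)) , w≋))
      where
      e = proj₁ (inverse (a zero) a₀≉0)
      a₀e≈1 = proj₂ (inverse (a zero) a₀≉0)
      w≋ : w ≋ lincomb (λ i → - e * a (suc i)) u
      w≋ t = begin
        w t                               ≈⟨ *-identityˡ (w t) ⟨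
        1# * w t                          ≈⟨ *-congʳ (trans (sym a₀e≈1) (*-comm (a zero) e)) ⟩
        (e * a zero) * w t                ≈⟨ *-assoc e (a zero) (w t) ⟩
        e * (a zero * w t)                ≈⟨ *-congˡ (inverseˡ-unique _ _ (a·wu≈0 t)) ⟩
        e * - lincomb (tail a) u t        ≈⟨ -‿distribʳ-* e _ ⟨
        - (e * lincomb (tail a) u t)      ≈⟨ -‿distribˡ-* e _ ⟩
        - e * lincomb (tail a) u t        ≈⟨ *-lincomb (- e) (tail a) u t ⟩
        lincomb (λ i → - e * a (suc i)) u t ∎

    module WithEnumeration (q : ℕ) (enum : Fin q → Carrier) (enum-sur : ∀ a → ∃ λ i → enum i ≈ a) where

      InSpan? : ∀ {s n} (b : Fin s → Vector Carrier n) w → Dec (InSpan b w)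
      InSpan? {s} b w = Dec.map′
        (λ (code , w≋) → (enum ∘ lookup code) , w≋)
        (λ (c , w≋) → tabulate (proj₁ ∘ enum-sur ∘ c) ,
                      λ t → trans (w≋ t) (lincomb-congˡ b (enum-tabulate c) t))
        (∃-vec? s (λ code → all? (λ t → w t ≟ lincomb (enum ∘ lookup code) b t)))
        where
        enum-tabulate : ∀ c i → c i ≈ enum (lookup (tabulate (proj₁ ∘ enum-sur ∘ c)) i)
        enum-tabulate c i rewrite lookup∘tabulate (proj₁ ∘ enum-sur ∘ c) i = sym (proj₂ (enum-sur (c i)))

      record Basis {k n} (v : Fin k → Vector Carrier n) : Set where
        field
          rank            : ℕ
          index           : Fin rank → Fin k
          index-injective : Injective _≡_ _≡_ index
          independent     : Independent (v ∘ index)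
          spanning        : ∀ i → InSpan (v ∘ index) (v i)

      basis : ∀ {k n} (v : Fin k → Vector Carrier n) → Basis v
      basis {zero} v = record
        { rank = 0 ; index = λ () ; index-injective = λ { {()} } ; independent = λ _ _ () ; spanning = λ () }
      basis {suc k} v with basis (tail v)
      ... | B with InSpan? (tail v ∘ Basis.index B) (v zero)
      ... | yes v₀∈B = record
        { rank = rank ; index = suc ∘ index ; index-injective = index-injective ∘ suc-injective
        ; independent = independent ; spanning = λ { zero → v₀∈B ; (suc i) → spanning i } }
        where open Basis B
      ... | no v₀∉B = record
        { rank = suc rank ; index = zero ∷ᵥ suc ∘ index ; index-injective = injective
        ; independent = independent-∷ independent v₀∉B
        ; spanning = λ { zero    → InSpan-head (tail v ∘ index) (v zero)
                       ; (suc i) → InSpan-∷ (tail v ∘ index) (v zero) (spanning i) } }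
        where
        open Basis B
        injective : Injective _≡_ _≡_ (zero ∷ᵥ suc ∘ index)
        injective {zero}  {zero}  _  = ≡.refl
        injective {suc i} {suc j} eq = ≡.cong suc (index-injective (suc-injective eq))
        injective {zero}  {suc _} ()
        injective {suc _} {zero}  ()

      independent-or-spanned : ∀ {k n} d (v : Fin k → Vector Carrier n) →
        (∃ λ (g : Fin (suc d) → Fin k) → Injective _≡_ _≡_ g × Independent (v ∘ g)) ⊎
        (∃ λ (b : Fin d → Vector Carrier n) → ∀ i → InSpan b (v i))
      independent-or-spanned d v with basis v
      ... | B with suc d ℕ.≤? Basis.rank B
      ... | yes d<rank =
        let g , g-injective , g-independent = truncate (v ∘ index) (≤⇒≤′ d<rank) independent
        in inj₁ (index ∘ g , g-injective ∘ index-injective , g-independent)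
        where open Basis B
      ... | no d≮rank =
        let b , index⊆b = pad (≤⇒≤′ (≤-pred (≰⇒> d≮rank))) (v ∘ index)
        in inj₂ (b , index⊆b ∘ spanning)
        where open Basis B

module Orthogonality (D : DVF) where
  open ≡ using (refl; sym; trans; cong; subst)
  open DVF D
  open Vectors D
  module LK = Linear K
  module LF = Linear F
  open LF.WithDecidableEquality _≟F_
  open WithEnumeration q enum enum-sur

  Integral : K.Carrier → Set
  Integral x = fin 0ℤ ≤∞ ν x

  integral-* : ∀ {x y} → Integral x → Integral y → Integral (x K.* y)
  integral-* {x} {y} 0≤x 0≤y = subst (fin 0ℤ ≤∞_) (sym (ν-mul x y)) (+∞-nonneg 0≤x 0≤y)

  red-0 : red K.0# F.≈ F.0#
  red-0 = red-ker⇐ K.0# (subst (fin 0ℤ <∞_) (sym ν-0) fin<∞)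

  integral-lincomb : ∀ {m n} (c : Fin m → K.Carrier) (u : Fin m → Vecₖ n) →
                     (∀ i → Integral (c i)) → (∀ i t → Integral (u i t)) →
                     ∀ t → Integral (LK.lincomb c u t)
  integral-lincomb {zero}  c u _   _   t = subst (fin 0ℤ ≤∞_) (sym ν-0) (_ ≤∞∞)
  integral-lincomb {suc m} c u 0≤c 0≤u t = ≤∞-trans
    (min∞-glb (integral-* (0≤c zero) (0≤u zero t))
              (integral-lincomb (tail c) (tail u) (0≤c ∘ suc) (0≤u ∘ suc) t))
    (ν-add _ _)

  red-lincomb : ∀ {m n} (c : Fin m → K.Carrier) (u : Fin m → Vecₖ n) →
                (∀ i → Integral (c i)) → (∀ i t → Integral (u i t)) →
                ∀ t → red (LK.lincomb c u t) F.≈ LF.lincomb (red ∘ c) (γ ∘ u) t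
  red-lincomb {zero}  c u _   _   t = red-0
  red-lincomb {suc m} c u 0≤c 0≤u t = F.trans
    (red-+ _ _ (integral-* (0≤c zero) (0≤u zero t))
               (integral-lincomb (tail c) (tail u) (0≤c ∘ suc) (0≤u ∘ suc) t))
    (F.+-cong (red-* _ _ (0≤c zero) (0≤u zero t))
              (red-lincomb (tail c) (tail u) (0≤c ∘ suc) (0≤u ∘ suc) t))

  InB-integral : ∀ {n} {u : Vecₖ n} → InB u → ∀ t → Integral (u t)
  InB-integral {n} {u} u∈B t = subst (_≤∞ ν (u t)) u∈B (minFin-≤ n _ t)

  νᵥ>0⇒γ≈0 : ∀ {n} (v : Vecₖ n) → fin 0ℤ <∞ νᵥ v → ∀ t → γ v t F.≈ F.0#
  νᵥ>0⇒γ≈0 {n} v 0<v t = red-ker⇐ (v t) (<∞-≤∞-trans 0<v (minFin-≤ n _ t))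

  γ≈0⇒νᵥ>0 : ∀ {n} (v : Vecₖ n) → (∀ t → Integral (v t)) →
             (∀ t → γ v t F.≈ F.0#) → fin 0ℤ <∞ νᵥ v
  γ≈0⇒νᵥ>0 {n} v 0≤v γv≈0 = minFin-glb< n _ (λ t → red-ker⇒ (v t) (0≤v t) (γv≈0 t))

  InB⇒γ≉0 : ∀ {n} {u : Vecₖ n} → InB u → ¬ (∀ t → γ u t F.≈ F.0#)
  InB⇒γ≉0 {u = u} u∈B γu≈0 =
    <∞-irrefl (subst (fin 0ℤ <∞_) u∈B (γ≈0⇒νᵥ>0 u (InB-integral u∈B) γu≈0))

  νᵥ-scale : ∀ {n} c (u : Vecₖ n) → νᵥ (scale c u) ≡ ν c +∞ νᵥ u
  νᵥ-scale {n} c u = trans (minFin-cong n (λ t → ν-mul c (u t))) (minFin-+ n (ν c) _)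

  νᵥ-cong : ∀ {n} {u v : Vecₖ n} → u ≈ᵥ v → νᵥ u ≡ νᵥ v
  νᵥ-cong {n} u≈v = minFin-cong n (ν-cong ∘ u≈v)

  lincomb≈ᵥsum : ∀ {m n} (c : Fin m → K.Carrier) (u : Fin m → Vecₖ n) → lincomb c u ≈ᵥ LK.lincomb c u
  lincomb≈ᵥsum {m} c u t = K.reflexive (LK.sumFin≡sum m _)

  module _ {m n} (u : Fin m → Vecₖ n) (u∈B : ∀ i → InB (u i)) where

    private
      u-integral : ∀ i t → Integral (u i t)
      u-integral i = InB-integral (u∈B i)

    minFin-νᵥ-scale : ∀ c → minFin m (λ i → νᵥ (scale (c i) (u i))) ≡ minFin m (ν ∘ c)
    minFin-νᵥ-scale c = minFin-cong m λ i →
      trans (νᵥ-scale (c i) (u i)) (trans (cong (ν (c i) +∞_) (u∈B i)) (+∞-identityʳ (ν (c i))))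

    orthogonal⇒independent : Orthogonal u → LF.Independent (γ ∘ u)
    orthogonal⇒independent (_ , orth) a a·γu≈0 i = F.trans (F.sym (red-lift i)) (red-ker⇐ (c i) 0<cᵢ)
      where
      c : Fin m → K.Carrier
      c i = proj₁ (red-sur (a i))
      c-integral : ∀ i → Integral (c i)
      c-integral i = proj₁ (proj₂ (red-sur (a i)))
      red-lift : ∀ i → red (c i) F.≈ a i
      red-lift i = proj₂ (proj₂ (red-sur (a i)))
      γ-c·u≈0 : ∀ t → γ (LK.lincomb c u) t F.≈ F.0#
      γ-c·u≈0 t = F.trans (red-lincomb c u c-integral u-integral t)
                          (F.trans (LF.lincomb-congˡ (γ ∘ u) red-lift t) (a·γu≈0 t))
      0<min : fin 0ℤ <∞ minFin m (ν ∘ c)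
      0<min = subst (fin 0ℤ <∞_)
                    (trans (sym (νᵥ-cong (lincomb≈ᵥsum c u))) (trans (orth c) (minFin-νᵥ-scale c)))
                    (γ≈0⇒νᵥ>0 _ (integral-lincomb c u c-integral u-integral) γ-c·u≈0)
      0<cᵢ : fin 0ℤ <∞ ν (c i)
      0<cᵢ = <∞-≤∞-trans 0<min (minFin-≤ m _ i)

    independent⇒νᵥ-lincomb≡0 : LF.Independent (γ ∘ u) → ∀ d → (∀ i → Integral (d i)) →
                               ∀ i₀ → ν (d i₀) ≡ fin 0ℤ → νᵥ (LK.lincomb d u) ≡ fin 0ℤ
    independent⇒νᵥ-lincomb≡0 ind d d-integral i₀ νdᵢ₀≡0 =
      ≤∞∧≮∞⇒≡ (minFin-glb n _ (integral-lincomb d u d-integral u-integral)) λ 0<d·u →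
        red-dᵢ₀≉0 (ind (red ∘ d) (λ t →
          F.trans (F.sym (red-lincomb d u d-integral u-integral t)) (νᵥ>0⇒γ≈0 _ 0<d·u t)) i₀)
      where
      red-dᵢ₀≉0 : ¬ (red (d i₀) F.≈ F.0#)
      red-dᵢ₀≉0 r = <∞-irrefl (subst (fin 0ℤ <∞_) νdᵢ₀≡0 (red-ker⇒ (d i₀) (d-integral i₀) r))

    νᵥ-lincomb-∞ : ∀ c → minFin m (ν ∘ c) ≡ ∞ → νᵥ (LK.lincomb c u) ≡ ∞
    νᵥ-lincomb-∞ c min≡∞ = ∞≤∞⇒≡∞ (minFin-glb n _ λ t →
      subst (∞ ≤∞_) (sym (trans (ν-cong (LK.lincomb-zeroˡ u c≈0 t)) ν-0)) (∞ ≤∞∞))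
      where
      c≈0 : ∀ i → c i K.≈ K.0#
      c≈0 i = ν-∞⇒0 (c i) (∞≤∞⇒≡∞ (subst (_≤∞ ν (c i)) min≡∞ (minFin-≤ m _ i)))

    independent⇒νᵥ-lincomb-fin : LF.Independent (γ ∘ u) → ∀ c z → minFin m (ν ∘ c) ≡ fin z →
                                 νᵥ (LK.lincomb c u) ≡ fin z
    independent⇒νᵥ-lincomb-fin ind c z min≡z =
      Equivalence.to (neg-+∞-zero z _)
        (trans (sym νᵥ-d·u) (independent⇒νᵥ-lincomb≡0 ind d d-integral i₀ νdᵢ₀≡0))
      where
      -- scaling c by x, with ν x = - z, makes its smallest valuation 0
      i₀ = proj₁ (minFin-attained m (ν ∘ c) min≡z)
      x = proj₁ (ν-surj (ℤ.- z))
      νx≡-z = proj₂ (ν-surj (ℤ.- z))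
      d : Fin m → K.Carrier
      d i = x K.* c i
      νd : ∀ i → ν (d i) ≡ fin (ℤ.- z) +∞ ν (c i)
      νd i = trans (ν-mul x (c i)) (cong (_+∞ ν (c i)) νx≡-z)
      d-integral : ∀ i → Integral (d i)
      d-integral i = subst (fin 0ℤ ≤∞_) (sym (νd i))
        (neg-+∞-nonneg z (subst (_≤∞ ν (c i)) min≡z (minFin-≤ m _ i)))
      νdᵢ₀≡0 : ν (d i₀) ≡ fin 0ℤ
      νdᵢ₀≡0 = trans (νd i₀)
                     (Equivalence.from (neg-+∞-zero z _) (proj₂ (minFin-attained m (ν ∘ c) min≡z)))
      νᵥ-d·u : νᵥ (LK.lincomb d u) ≡ fin (ℤ.- z) +∞ νᵥ (LK.lincomb c u)
      νᵥ-d·u = trans (νᵥ-cong (λ t → K.sym (LK.*-lincomb x c u t)))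
                     (trans (νᵥ-scale x (LK.lincomb c u)) (cong (_+∞ νᵥ (LK.lincomb c u)) νx≡-z))

    independent⇒orthogonal : LF.Independent (γ ∘ u) → Orthogonal u
    independent⇒orthogonal ind = (λ i → fin≢∞ ∘ trans (sym (u∈B i))) , λ c →
      trans (νᵥ-cong (lincomb≈ᵥsum c u)) (trans (νᵥ-lincomb-min c) (sym (minFin-νᵥ-scale c)))
      where
      νᵥ-lincomb-min : ∀ c → νᵥ (LK.lincomb c u) ≡ minFin m (ν ∘ c)
      νᵥ-lincomb-min c with minFin m (ν ∘ c) in min≡
      ... | ∞     = νᵥ-lincomb-∞ c min≡
      ... | fin z = independent⇒νᵥ-lincomb-fin ind c z min≡

  projSpan : ∀ {d n} → (Fin d → Vecꜰ n) → ProjSubset n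
  projSpan b = record
    { Rep      = λ w → (¬ ∀ t → w t F.≈ F.0#) × LF.InSpan b w
    ; nonzero  = λ _ → proj₁
    ; resp     = λ _ _ w≈w′ (w≉0 , w∈b) →
        (λ w′≈0 → w≉0 (λ t → F.trans (w≈w′ t) (w′≈0 t))) , LF.InSpan-resp b w≈w′ w∈b
    ; scaled   = λ _ c c≉0 (w≉0 , w∈b) →
        (λ cw≈0 → w≉0 (LF.*-cancelˡ-0 c≉0 ∘ cw≈0)) , LF.InSpan-* b c w∈b
    ; unscaled = λ w c c≉0 (cw≉0 , cw∈b) →
        (λ w≈0 → cw≉0 (λ t → F.trans (F.*-congˡ (w≈0 t)) (F.zeroʳ c))) ,
        LF.InSpan-resp b (LF.inverse-cancelˡ c≉0 ∘ w) (LF.InSpan-* b _ cw∈b)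
    }

  projSpan-dim : ∀ {d n} (b : Fin d → Vecꜰ n) → SpanDim≤ (projSpan b) d
  projSpan-dim {d} b = b , λ { w (_ , c , w≋cb) →
    c , λ t → F.trans (w≋cb t) (F.reflexive (sym (LF.sumFin≡sum d _))) }

  SpanDim≤⇒InSpan : ∀ {d n} (I : ProjSubset n) → ((b , _) : SpanDim≤ I d) →
                    ∀ {w} → ProjSubset.Rep I w → LF.InSpan b w
  SpanDim≤⇒InSpan {d} I (b , I⊆b) w∈I with I⊆b _ w∈I
  ... | c , w≈cb = c , λ t → F.trans (w≈cb t) (F.reflexive (LF.sumFin≡sum d _))

  module _ {n} (S : Vecₖ n → Set) (S⊆B : ∀ v → S v → InB v) where

    kl-orthogonal⇒count-below : ∀ {k d} → KLOrthogonal k (suc d) S →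
                                ∀ I → SpanDim≤ I d → CountBelow k S I
    kl-orthogonal⇒count-below kl I I≤d (f , f∈S∩I , distinct) with kl f (proj₁ ∘ f∈S∩I) distinct
    ... | g , _ , orth = LF.dependent⇒¬independent {u = γ ∘ f ∘ g}
      (span-dependent (proj₁ I≤d) (γ ∘ f ∘ g)
        (λ i → SpanDim≤⇒InSpan I I≤d (proj₂ (f∈S∩I (g i)))))
      (orthogonal⇒independent (f ∘ g) (λ i → S⊆B _ (proj₁ (f∈S∩I (g i)))) orth)

    count-below⇒kl-orthogonal : ∀ {k d} → (∀ I → SpanDim≤ I d → CountBelow k S I) →
                                KLOrthogonal k (suc d) S
    count-below⇒kl-orthogonal {d = d} count f f∈S distinct with independent-or-spanned d (γ ∘ f)
    ... | inj₁ (g , g-injective , independent) =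
      g , (λ _ _ → g-injective) , independent⇒orthogonal (f ∘ g) (λ i → S⊆B _ (f∈S (g i))) independent
    ... | inj₂ (b , γf⊆b) = ⊥-elim (count (projSpan b) (projSpan-dim b)
      (f , (λ i → f∈S i , InB⇒γ≉0 (S⊆B _ (f∈S i)) , γf⊆b i) , distinct))

    kl-orthogonal⇔count-below : ∀ {k d} →
                                KLOrthogonal k (suc d) S ⇔ (∀ I → SpanDim≤ I d → CountBelow k S I)
    kl-orthogonal⇔count-below = mk⇔ kl-orthogonal⇒count-below count-below⇒kl-orthogonal

lemma2p2 : (D : DVF) → let open Vectors D in
    ∀ (n k ℓ : ℕ) → 1 ≤ n → 2 ≤ ℓ → ℓ ≤ k →
    (S : Vecₖ n → Set) → (∀ v → S v → InB v) →
    KLOrthogonal k ℓ S ⇔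
    (∀ (I : ProjSubset n) → SpanDim≤ I (ℓ ∸ 1) → CountBelow k S I)
lemma2p2 D n k (suc d) _ _ _ S S⊆B = Orthogonality.kl-orthogonal⇔count-below D S S⊆B
lemma2p2 D n k zero    _ () _
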